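{- Suppose $A_1,\dots,A_m$ is an $(n,m;k_1,\dots,k_m;\lambda_1,\dots,\lambda_m)$-generalized strong external difference family in an additive abelian group $\mathcal{G}$ of order $n$, and let $a=\sum_{i=1}^m k_i$. Then the strong AMD code with sources $s_1,\dots,s_m$, $A(s_i)=A_i$ and equiprobable encoding is R-optimal, i.e. $\hat\epsilon_{s_i}=\frac{a-k_i}{n-1}$ for every $1\le i\le m$.
   Context: For disjoint subsets $A,B$ of $\mathcal{G}$, $\mathcal{D}(A,B)$ denotes the multiset $\{x-y : x\in A, y\in B\}$. An $(n,m;k_1,\dots,k_m;\lambda_1,\dots,\lambda_m)$-GSEDF is a collection of $m$ pairwise disjoint subsets $A_1,\dots,A_m$ of $\mathcal{G}$ with $|A_i|=k_i$ such that for every $i$, $\bigcup_{j\ne i}\mathcal{D}(A_i,A_j)=\lambda_i(\mathcal{G}\setminus\{0\})$ as multisets. An AMD code over $\mathcal{G}$ ($n\ge2$) with source set $\mathcal{S}$ consists of pairwise disjoint nonempty subsets $A(s)\subseteq\mathcal{G}$ and a public encoding function $E$ mapping $s$ to some $g\in A(s)$; equiprobable encoding means $E(s)$ is uniform on $A(s)$. Strong security game for a source $s$: $s$ is given to the adversary, who chooses $\Delta\in\mathcal{G}\setminus\{0\}$ by a (possibly randomized) strategy; then $g=E(s)$; the adversary wins iff $g+\Delta\in A(s')$ for some $s'\ne s$. $\hat\epsilon_s$ is the maximum winning probability over all strategies for source $s$. With $a_s=|A(s)|$ and $a=\sum_s a_s$, the code is R-optimal if $\hat\epsilon_s=(a-a_s)/(n-1)$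 for every source $s$.
   Formalization: The adversary's randomized strategies, over which $\hat\epsilon_{s_i}$ is the maximum, are probability distributions on the nonzero elements of the group with rational weights. -}

module Defs where

open import Data.Nat using (ℕ; zero; suc; _+_; _*_; _∸_; _≤_)
open import Data.Bool using (Bool; true; false; _∧_; _∨_; not; if_then_else_)
open import Data.Fin using (Fin; zero; suc)
open import Data.Fin.Subset using (Subset; _∈_; ∣_∣)
open import Data.Vec using (lookup)
open import Data.Integer using (+_)
open import Data.Rational as ℚ using (ℚ; 0ℚ; 1ℚ)
open import Data.Product using (Σ; _×_; _,_)
open import Relation.Binary.PropositionalEquality using (_≡_; _≢_)
open import Relation.Nullary.Decidable using (⌊_⌋)
open import Algebra.Structures using (IsAbelianGroup)
open import Data.Empty using (⊥)
import Data.Fin.Properties as FinP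

Σℕ : (n : ℕ) → (Fin n → ℕ) → ℕ
Σℕ zero    f = 0
Σℕ (suc n) f = f zero + Σℕ n (λ i → f (suc i))

Σℚ : (n : ℕ) → (Fin n → ℚ) → ℚ
Σℚ zero    f = 0ℚ
Σℚ (suc n) f = f zero ℚ.+ Σℚ n (λ i → f (suc i))

anyFin : (n : ℕ) → (Fin n → Bool) → Bool
anyFin zero    f = false
anyFin (suc n) f = f zero ∨ anyFin n (λ i → f (suc i))

ind : Bool → ℕ
ind true  = 1
ind false = 0

_==_ : {n : ℕ} → Fin n → Fin n → Bool
x == y = ⌊ x FinP.≟ y ⌋

-- the rational number a/d, with the convention a/0 = 0 (only used with d ≠ 0)
frac : ℕ → ℕ → ℚ
frac a zero    = 0ℚ
frac a (suc d) = (+ a) ℚ./ suc d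

record FinAbGroup (n : ℕ) : Set where
  field
    _⊕_   : Fin n → Fin n → Fin n
    𝟘     : Fin n
    ⊖_    : Fin n → Fin n
    isAbelianGroup : IsAbelianGroup _≡_ _⊕_ 𝟘 ⊖_

  _⊝_ : Fin n → Fin n → Fin n
  x ⊝ y = x ⊕ (⊖ y)

open FinAbGroup public

module _ {n m : ℕ} (G : FinAbGroup n) (A : Fin m → Subset n) where

  memB : Fin m → Fin n → Bool
  memB j x = lookup (A j) x

  -- multiplicity of g in the multiset  ⋃_{j ≠ i} D(A_i, A_j),
  -- where D(A_i,A_j) = { x - y : x ∈ A_i, y ∈ A_j }
  diffMult : Fin m → Fin n → ℕ
  diffMult i g =
    Σℕ m (λ j → ind (not (j == i)) *
      Σℕ n (λ x → Σℕ n (λ y →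
        ind (memB i x) * ind (memB j y) * ind (_⊝_ G x y == g))))

  PairwiseDisjoint : Set
  PairwiseDisjoint = ∀ i j → i ≢ j → ∀ x → x ∈ A i → x ∈ A j → ⊥

  -- (n,m;k_1..k_m;λ_1..λ_m)-GSEDF:  the multiset ⋃_{j≠i} D(A_i,A_j)
  -- equals λ_i copies of G \ {0}.
  IsGSEDF : (k : Fin m → ℕ) (λs : Fin m → ℕ) → Set
  IsGSEDF k λs =
    PairwiseDisjoint
    × (∀ i → ∣ A i ∣ ≡ k i)
    × (∀ i → diffMult i (𝟘 G) ≡ 0)
    × (∀ i g → g ≢ 𝟘 G → diffMult i g ≡ λs i)

  inOthers : Fin m → Fin n → Bool
  inOthers s h = anyFin m (λ s' → not (s' == s) ∧ memB s' h)

  encProb : Fin m → Fin n → ℚ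
  encProb s g = frac (ind (memB s g)) ∣ A s ∣

  winShift : Fin m → Fin n → ℚ
  winShift s Δ = Σℚ n (λ g → if inOthers s (_⊕_ G g Δ) then encProb s g else 0ℚ)

  record Strategy : Set where
    field
      prob     : Fin n → ℚ
      nonneg   : ∀ Δ → 0ℚ ℚ.≤ prob Δ
      zeroNull : prob (𝟘 G) ≡ 0ℚ
      total    : Σℚ n prob ≡ 1ℚ

  winProb : Fin m → Strategy → ℚ
  winProb s σ = Σℚ n (λ Δ → Strategy.prob σ Δ ℚ.* winShift s Δ)

  IsMaxWinProb : Fin m → ℚ → Set
  IsMaxWinProb s r = (∀ σ → winProb s σ ℚ.≤ r) × Σ Strategy (λ σ → winProb s σ ≡ r)

  totalSize : ℕ
  totalSize = Σℕ m (λ s → ∣ A s ∣)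

  IsROptimal : Set
  IsROptimal = ∀ s → IsMaxWinProb s (frac (totalSize ∸ ∣ A s ∣) (n ∸ 1))

-- Fix a source s and a nonzero shift Δ.  Because the A_j are disjoint, the
-- number of g ∈ A_s with g + Δ in some A_j, j ≠ s, is the number of pairs
-- (x, y) ∈ A_s × A_j (j ≠ s) with x − y = −Δ, i.e. the multiplicity λ_s of −Δ
-- in ⋃_{j≠s} D(A_s, A_j).  Counting all these differences at once gives
-- λ_s (n − 1) = k_s (a − k_s), so every nonzero shift wins with probability
-- λ_s / k_s = (a − k_s)/(n − 1).  A strategy is a distribution on nonzero
-- shifts, hence wins with exactly this probability, and a point mass attains it.
module Submission where

open import Defs
open import Data.Nat using (ℕ; zero; suc; _+_; _*_; _∸_; _≤_; s≤s)
import Data.Nat.Properties as ℕP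
open import Data.Bool using (Bool; true; false; _∧_; not; if_then_else_)
open import Data.Bool.Properties using (∧-conicalʳ)
open import Data.Empty using (⊥-elim)
open import Data.Fin using (Fin; zero; suc; punchIn)
open import Data.Fin.Properties using (_≟_; suc-injective; punchInᵢ≢i)
open import Data.Fin.Subset using (Subset; ∣_∣)
open import Data.Vec using ([]; _∷_; lookup)
open import Data.Vec.Properties using (lookup⇒[]=)
import Data.Integer as ℤ
import Data.Integer.Properties as ℤP
open import Data.Rational as ℚ using (ℚ; 0ℚ; 1ℚ)
import Data.Rational.Properties as ℚP
open import Data.Rational.Unnormalised as ℚᵘ using (mkℚᵘ; *≡*)
import Data.Rational.Unnormalised.Properties as ℚᵘP
open import Data.Product using (∃-syntax; _×_; _,_; proj₁; proj₂)
open import Function using (_∘_)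
open import Relation.Binary.PropositionalEquality
open import Relation.Nullary using (yes; no)
open import Relation.Nullary.Decidable using (isYes≗does; dec-true; dec-false)
open import Algebra.Bundles using (Ring; AbelianGroup)
import Algebra.Properties.Group
import Algebra.Properties.Quasigroup
open import Level using (0ℓ)
import Algebra.Properties.Semiring.Sum as SemiringSum
open import Algebra.Properties.CommutativeSemigroup ℕP.*-commutativeSemigroup
  using (x∙yz≈y∙xz)

module ℕΣ = SemiringSum ℕP.+-*-semiring
module ℚΣ = SemiringSum (Ring.semiring ℚP.+-*-ring)

private
  variable
    n m : ℕ

Σℕ≡sum : ∀ n (f : Fin n → ℕ) → Σℕ n f ≡ ℕΣ.sum f
Σℕ≡sum zero    f = refl
Σℕ≡sum (suc n) f = cong (f zero +_) (Σℕ≡sum n (f ∘ suc))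

Σℕ-cong : ∀ n {f g : Fin n → ℕ} → f ≗ g → Σℕ n f ≡ Σℕ n g
Σℕ-cong n {f} {g} f≗g =
  trans (Σℕ≡sum n f) (trans (ℕΣ.sum-cong-≗ f≗g) (sym (Σℕ≡sum n g)))

Σℕ-1 : ∀ n → Σℕ n (λ _ → 1) ≡ n
Σℕ-1 zero    = refl
Σℕ-1 (suc n) = cong suc (Σℕ-1 n)

Σℕ-zero : ∀ n {f : Fin n → ℕ} → (∀ i → f i ≡ 0) → Σℕ n f ≡ 0
Σℕ-zero n f≡0 =
  trans (Σℕ-cong n f≡0) (trans (Σℕ≡sum n _) (ℕΣ.sum-replicate-zero n))

Σℕ-distrib-+ : ∀ n (f g : Fin n → ℕ) → Σℕ n (λ i → f i + g i) ≡ Σℕ n f + Σℕ n g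
Σℕ-distrib-+ n f g = begin
  Σℕ n (λ i → f i + g i)  ≡⟨ Σℕ≡sum n _ ⟩
  ℕΣ.sum (λ i → f i + g i) ≡⟨ ℕΣ.∑-distrib-+ f g ⟩
  ℕΣ.sum f + ℕΣ.sum g      ≡⟨ sym (cong₂ _+_ (Σℕ≡sum n f) (Σℕ≡sum n g)) ⟩
  Σℕ n f + Σℕ n g          ∎
  where open ≡-Reasoning

Σℕ-comm : ∀ n m (f : Fin n → Fin m → ℕ) →
          Σℕ n (λ i → Σℕ m (f i)) ≡ Σℕ m (λ j → Σℕ n (λ i → f i j))
Σℕ-comm n m f = begin
  Σℕ n (λ i → Σℕ m (f i))           ≡⟨ Σℕ-cong n (λ i → Σℕ≡sum m (f i)) ⟩
  Σℕ n (λ i → ℕΣ.sum (f i))          ≡⟨ Σℕ≡sum n _ ⟩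
  ℕΣ.sum (λ i → ℕΣ.sum (f i))        ≡⟨ ℕΣ.∑-comm f ⟩
  ℕΣ.sum (λ j → ℕΣ.sum (λ i → f i j)) ≡⟨ sym (Σℕ≡sum m _) ⟩
  Σℕ m (λ j → ℕΣ.sum (λ i → f i j))  ≡⟨ sym (Σℕ-cong m (λ j → Σℕ≡sum n (λ i → f i j))) ⟩
  Σℕ m (λ j → Σℕ n (λ i → f i j))    ∎
  where open ≡-Reasoning

*-distribˡ-Σℕ : ∀ n c (f : Fin n → ℕ) → c * Σℕ n f ≡ Σℕ n (λ i → c * f i)
*-distribˡ-Σℕ n c f = begin
  c * Σℕ n f                 ≡⟨ cong (c *_) (Σℕ≡sum n f) ⟩
  c * ℕΣ.sum f               ≡⟨ ℕΣ.*-distribˡ-sum c f ⟩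
  ℕΣ.sum (λ i → c * f i)     ≡⟨ sym (Σℕ≡sum n _) ⟩
  Σℕ n (λ i → c * f i)       ∎
  where open ≡-Reasoning

*-distribʳ-Σℕ : ∀ n c (f : Fin n → ℕ) → Σℕ n f * c ≡ Σℕ n (λ i → f i * c)
*-distribʳ-Σℕ n c f = begin
  Σℕ n f * c              ≡⟨ ℕP.*-comm (Σℕ n f) c ⟩
  c * Σℕ n f              ≡⟨ *-distribˡ-Σℕ n c f ⟩
  Σℕ n (λ i → c * f i)    ≡⟨ Σℕ-cong n (λ i → ℕP.*-comm c (f i)) ⟩
  Σℕ n (λ i → f i * c)    ∎
  where open ≡-Reasoning

==-refl : (x : Fin n) → (x == x) ≡ true
==-refl x = trans (isYes≗does (x ≟ x)) (dec-true (x ≟ x) refl)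

≢⇒==-false : {x y : Fin n} → x ≢ y → (x == y) ≡ false
≢⇒==-false {x = x} {y} x≢y = trans (isYes≗does (x ≟ y)) (dec-false (x ≟ y) x≢y)

==-cong : {x y : Fin n} {u v : Fin m} →
          (x ≡ y → u ≡ v) → (u ≡ v → x ≡ y) → (x == y) ≡ (u == v)
==-cong {x = x} {y} {u} {v} to from with x ≟ y
... | yes x≡y = sym (trans (isYes≗does (u ≟ v)) (dec-true (u ≟ v) (to x≡y)))
... | no  x≢y = sym (≢⇒==-false (x≢y ∘ from))

==-sym : (x y : Fin n) → (x == y) ≡ (y == x)
==-sym x y = ==-cong sym sym

ind≢ : Fin n → Fin n → ℕ
ind≢ y c = ind (not (y == c))

Σℕ-delta : ∀ n (c : Fin n) (f : Fin n → ℕ) → Σℕ n (λ y → f y * ind (y == c)) ≡ f c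
Σℕ-delta (suc n) c f = begin
  Σℕ (suc n) t                         ≡⟨ Σℕ≡sum (suc n) t ⟩
  ℕΣ.sum t                             ≡⟨ ℕΣ.sum-remove t ⟩
  t c + ℕΣ.sum (t ∘ punchIn c)         ≡⟨ cong₂ _+_ t-at-c (sym (Σℕ≡sum n _)) ⟩
  f c + Σℕ n (t ∘ punchIn c)           ≡⟨ cong (f c +_) (Σℕ-zero n t-off-c) ⟩
  f c + 0                              ≡⟨ ℕP.+-identityʳ (f c) ⟩
  f c                                  ∎
  where
  open ≡-Reasoning
  t : Fin (suc n) → ℕ
  t y = f y * ind (y == c)
  t-at-c : t c ≡ f c
  t-at-c = trans (cong (λ b → f c * ind b) (==-refl c)) (ℕP.*-identityʳ (f c))
  t-off-c : ∀ j → t (punchIn c j) ≡ 0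
  t-off-c j = trans (cong (λ b → f (punchIn c j) * ind b) (≢⇒==-false (punchInᵢ≢i c j)))
                    (ℕP.*-zeroʳ (f (punchIn c j)))

ind-∧ : ∀ a b → ind (a ∧ b) ≡ ind a * ind b
ind-∧ true  b = sym (ℕP.+-identityʳ (ind b))
ind-∧ false b = refl

ind+ind-not : ∀ b → ind b + ind (not b) ≡ 1
ind+ind-not true  = refl
ind+ind-not false = refl

Σℕ-split : ∀ n (c : Fin n) (f : Fin n → ℕ) →
           Σℕ n f ≡ f c + Σℕ n (λ y → ind≢ y c * f y)
Σℕ-split n c f = begin
  Σℕ n f
    ≡⟨ Σℕ-cong n (λ y → sym (trans (sym (ℕP.*-distribˡ-+ (f y) _ _))
                                   (trans (cong (f y *_) (ind+ind-not (y == c))) (ℕP.*-identityʳ (f y))))) ⟩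
  Σℕ n (λ y → f y * ind (y == c) + f y * ind (not (y == c)))
    ≡⟨ Σℕ-distrib-+ n _ _ ⟩
  Σℕ n (λ y → f y * ind (y == c)) + Σℕ n (λ y → f y * ind (not (y == c)))
    ≡⟨ cong₂ _+_ (Σℕ-delta n c f) (Σℕ-cong n (λ y → ℕP.*-comm (f y) _)) ⟩
  f c + Σℕ n (λ y → ind≢ y c * f y)
    ∎
  where open ≡-Reasoning

∸1≡Σℕ-ind≢ : ∀ n (c : Fin n) → n ∸ 1 ≡ Σℕ n (λ y → ind≢ y c)
∸1≡Σℕ-ind≢ n c = begin
  n ∸ 1                              ≡⟨ cong (_∸ 1) (sym (Σℕ-1 n)) ⟩
  Σℕ n (λ _ → 1) ∸ 1                 ≡⟨ cong (_∸ 1) (Σℕ-split n c (λ _ → 1)) ⟩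
  1 + Σℕ n (λ y → ind≢ y c * 1) ∸ 1  ≡⟨ Σℕ-cong n (λ y → ℕP.*-identityʳ (ind≢ y c)) ⟩
  Σℕ n (λ y → ind≢ y c)              ∎
  where open ≡-Reasoning

∣p∣≡Σℕ-lookup : (p : Subset n) → ∣ p ∣ ≡ Σℕ n (λ x → ind (lookup p x))
∣p∣≡Σℕ-lookup []          = refl
∣p∣≡Σℕ-lookup (true  ∷ p) = cong suc (∣p∣≡Σℕ-lookup p)
∣p∣≡Σℕ-lookup (false ∷ p) = ∣p∣≡Σℕ-lookup p

ind-anyFin : ∀ m (f : Fin m → Bool) → (∀ i j → f i ≡ true → f j ≡ true → i ≡ j) →
             ind (anyFin m f) ≡ Σℕ m (ind ∘ f)
ind-anyFin zero    f unique = refl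
ind-anyFin (suc m) f unique with f zero in f0
... | true  = cong suc (sym (Σℕ-zero m rest-false))
  where
  rest-false : ∀ j → ind (f (suc j)) ≡ 0
  rest-false j with f (suc j) in fj
  ... | true  with () ← unique zero (suc j) f0 fj
  ... | false = refl
... | false = ind-anyFin m (f ∘ suc) (λ i j p q → suc-injective (unique (suc i) (suc j) p q))

module FinAbGroupProperties (G : FinAbGroup n) where

  abelianGroup : AbelianGroup 0ℓ 0ℓ
  abelianGroup = record { isAbelianGroup = isAbelianGroup G }

  open AbelianGroup abelianGroup using (_∙_; _⁻¹; _-_; ε; comm; group)
  open Algebra.Properties.Group group using (//-rightDividesˡ; quasigroup; ⁻¹-involutive; ⁻¹-injective; ε⁻¹≈ε)
  open Algebra.Properties.Quasigroup quasigroup using (x≈z//y)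

  -‿swap : ∀ {x y z} → x - y ≡ z → x - z ≡ y
  -‿swap {x} {y} {z} x-y≡z = sym (x≈z//y y z x (begin
    y ∙ z        ≡⟨ comm y z ⟩
    z ∙ y        ≡⟨ cong (_∙ y) (sym x-y≡z) ⟩
    (x - y) ∙ y  ≡⟨ //-rightDividesˡ y x ⟩
    x            ∎))
    where open ≡-Reasoning

  -‿⁻¹ : ∀ x y → x - y ⁻¹ ≡ x ∙ y
  -‿⁻¹ x y = cong (x ∙_) (⁻¹-involutive y)

  ⁻¹-≢ε : ∀ {x} → x ≢ ε → x ⁻¹ ≢ ε
  ⁻¹-≢ε x≢ε x⁻¹≡ε = x≢ε (⁻¹-injective (trans x⁻¹≡ε (sym ε⁻¹≈ε)))

frac-0 : ∀ d → frac 0 d ≡ 0ℚ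
frac-0 zero    = refl
frac-0 (suc d) = ℚP.0/n≡0 (suc d)

frac-nonneg : ∀ a d → 0ℚ ℚ.≤ frac a d
frac-nonneg a zero    = ℚP.≤-refl
frac-nonneg a (suc d) = ℚP.nonNegative⁻¹ (frac a (suc d)) {{ℚP.normalize-nonNeg a (suc d)}}

+-mkℚᵘ-same-denominator : ∀ a b d →
  mkℚᵘ (ℤ.+ a) d ℚᵘ.+ mkℚᵘ (ℤ.+ b) d ℚᵘ.≃ mkℚᵘ (ℤ.+ (a + b)) d
+-mkℚᵘ-same-denominator a b d = *≡* (begin
  (ℤ.+ a ℤ.* D ℤ.+ ℤ.+ b ℤ.* D) ℤ.* D ≡⟨ cong (ℤ._* D) (sym (ℤP.*-distribʳ-+ D (ℤ.+ a) (ℤ.+ b))) ⟩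
  ((ℤ.+ a ℤ.+ ℤ.+ b) ℤ.* D) ℤ.* D     ≡⟨ ℤP.*-assoc (ℤ.+ a ℤ.+ ℤ.+ b) D D ⟩
  (ℤ.+ a ℤ.+ ℤ.+ b) ℤ.* (D ℤ.* D)     ≡⟨ cong₂ ℤ._*_ (sym (ℤP.pos-+ a b)) (sym (ℤP.pos-* (suc d) (suc d))) ⟩
  ℤ.+ (a + b) ℤ.* ℤ.+ (suc d * suc d)  ∎)
  where
  open ≡-Reasoning
  D = ℤ.+ suc d

frac-+ : ∀ a b d → frac a d ℚ.+ frac b d ≡ frac (a + b) d
frac-+ a b zero    = ℚP.+-identityˡ 0ℚ
frac-+ a b (suc d) = ℚP.toℚᵘ-injective (begin
  ℚ.toℚᵘ (frac a (suc d) ℚ.+ frac b (suc d))           ≈⟨ ℚP.toℚᵘ-homo-+ (frac a (suc d)) (frac b (suc d)) ⟩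
  ℚ.toℚᵘ (frac a (suc d)) ℚᵘ.+ ℚ.toℚᵘ (frac b (suc d)) ≈⟨ ℚᵘP.+-cong (ℚP.toℚᵘ-fromℚᵘ (mkℚᵘ (ℤ.+ a) d))
                                                                    (ℚP.toℚᵘ-fromℚᵘ (mkℚᵘ (ℤ.+ b) d)) ⟩
  mkℚᵘ (ℤ.+ a) d ℚᵘ.+ mkℚᵘ (ℤ.+ b) d                  ≈⟨ +-mkℚᵘ-same-denominator a b d ⟩
  mkℚᵘ (ℤ.+ (a + b)) d                               ≈⟨ ℚᵘP.≃-sym (ℚP.toℚᵘ-fromℚᵘ (mkℚᵘ (ℤ.+ (a + b)) d)) ⟩
  ℚ.toℚᵘ (frac (a + b) (suc d))                       ∎)
  where open ℚᵘP.≃-Reasoning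

frac-cross : ∀ p q r t → 1 ≤ q → 1 ≤ t → p * t ≡ r * q → frac p q ≡ frac r t
frac-cross p (suc q) r (suc t) _ _ pt≡rq =
  ℚP.fromℚᵘ-cong {mkℚᵘ (ℤ.+ p) q} {mkℚᵘ (ℤ.+ r) t} (*≡* (begin
  ℤ.+ p ℤ.* ℤ.+ suc t  ≡⟨ sym (ℤP.pos-* p (suc t)) ⟩
  ℤ.+ (p * suc t)      ≡⟨ cong ℤ.+_ pt≡rq ⟩
  ℤ.+ (r * suc q)      ≡⟨ ℤP.pos-* r (suc q) ⟩
  ℤ.+ r ℤ.* ℤ.+ suc q  ∎))
  where open ≡-Reasoning

Σℚ≡sum : ∀ n (f : Fin n → ℚ) → Σℚ n f ≡ ℚΣ.sum f
Σℚ≡sum zero    f = refl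
Σℚ≡sum (suc n) f = cong (f zero ℚ.+_) (Σℚ≡sum n (f ∘ suc))

Σℚ-cong : ∀ n {f g : Fin n → ℚ} → f ≗ g → Σℚ n f ≡ Σℚ n g
Σℚ-cong n {f} {g} f≗g =
  trans (Σℚ≡sum n f) (trans (ℚΣ.sum-cong-≗ f≗g) (sym (Σℚ≡sum n g)))

*-distribʳ-Σℚ : ∀ n c (f : Fin n → ℚ) → Σℚ n f ℚ.* c ≡ Σℚ n (λ i → f i ℚ.* c)
*-distribʳ-Σℚ n c f = begin
  Σℚ n f ℚ.* c              ≡⟨ cong (ℚ._* c) (Σℚ≡sum n f) ⟩
  ℚΣ.sum f ℚ.* c            ≡⟨ ℚΣ.*-distribʳ-sum c f ⟩
  ℚΣ.sum (λ i → f i ℚ.* c)  ≡⟨ sym (Σℚ≡sum n _) ⟩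
  Σℚ n (λ i → f i ℚ.* c)    ∎
  where open ≡-Reasoning

Σℚ-frac : ∀ n (f : Fin n → ℕ) d → Σℚ n (λ i → frac (f i) d) ≡ frac (Σℕ n f) d
Σℚ-frac zero    f d = sym (frac-0 d)
Σℚ-frac (suc n) f d =
  trans (cong (frac (f zero) d ℚ.+_) (Σℚ-frac n (f ∘ suc) d)) (frac-+ (f zero) _ d)

if-frac : ∀ b a d → (if b then frac a d else 0ℚ) ≡ frac (a * ind b) d
if-frac true  a d = cong (λ x → frac x d) (sym (ℕP.*-identityʳ a))
if-frac false a d = sym (trans (cong (λ x → frac x d) (ℕP.*-zeroʳ a)) (frac-0 d))

∃-≢ : 2 ≤ n → (z : Fin n) → ∃[ d ] d ≢ z
∃-≢ (s≤s (s≤s _)) z = punchIn z zero , punchInᵢ≢i z zero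

module _ (G : FinAbGroup n) (A : Fin m → Subset n) where

  pointStrategy : (d : Fin n) → d ≢ 𝟘 G → Strategy G A
  pointStrategy d d≢0 = record
    { prob     = λ Δ → frac (ind (Δ == d)) 1
    ; nonneg   = λ Δ → frac-nonneg (ind (Δ == d)) 1
    ; zeroNull = trans (cong (λ b → frac (ind b) 1) (≢⇒==-false (d≢0 ∘ sym))) (frac-0 1)
    ; total    = trans (Σℚ-frac n (λ Δ → ind (Δ == d)) 1) (cong (λ k → frac k 1) point-mass)
    }
    where
    point-mass : Σℕ n (λ Δ → ind (Δ == d)) ≡ 1
    point-mass = trans (Σℕ-cong n (λ Δ → sym (ℕP.*-identityˡ (ind (Δ == d))))) (Σℕ-delta n d (λ _ → 1))

  winProb-constant : ∀ s r → (∀ Δ → Δ ≢ 𝟘 G → winShift G A s Δ ≡ r) →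
                     ∀ σ → winProb G A s σ ≡ r
  winProb-constant s r constant σ = begin
    Σℚ n (λ Δ → prob Δ ℚ.* winShift G A s Δ) ≡⟨ Σℚ-cong n weight ⟩
    Σℚ n (λ Δ → prob Δ ℚ.* r)                ≡⟨ sym (*-distribʳ-Σℚ n r prob) ⟩
    Σℚ n prob ℚ.* r                          ≡⟨ cong (ℚ._* r) total ⟩
    1ℚ ℚ.* r                                 ≡⟨ ℚP.*-identityˡ r ⟩
    r                                        ∎
    where
    open ≡-Reasoning
    open Strategy σ
    weight : ∀ Δ → prob Δ ℚ.* winShift G A s Δ ≡ prob Δ ℚ.* r
    weight Δ with Δ ≟ 𝟘 G
    ... | yes refl = begin
      prob (𝟘 G) ℚ.* winShift G A s (𝟘 G) ≡⟨ cong (ℚ._* _) zeroNull ⟩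
      0ℚ ℚ.* winShift G A s (𝟘 G)         ≡⟨ ℚP.*-zeroˡ (winShift G A s (𝟘 G)) ⟩
      0ℚ                                 ≡⟨ sym (ℚP.*-zeroˡ r) ⟩
      0ℚ ℚ.* r                           ≡⟨ cong (ℚ._* r) (sym zeroNull) ⟩
      prob (𝟘 G) ℚ.* r                   ∎
    ... | no Δ≢0 = cong (prob Δ ℚ.*_) (constant Δ Δ≢0)

  constant-winShift⇒IsMaxWinProb : 2 ≤ n → ∀ s r →
    (∀ Δ → Δ ≢ 𝟘 G → winShift G A s Δ ≡ r) → IsMaxWinProb G A s r
  constant-winShift⇒IsMaxWinProb 2≤n s r constant =
    (λ σ → ℚP.≤-reflexive (winProb-constant s r constant σ)) ,
    (σ₀ , winProb-constant s r constant σ₀)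
    where
    σ₀ : Strategy G A
    σ₀ = pointStrategy (proj₁ (∃-≢ 2≤n (𝟘 G))) (proj₂ (∃-≢ 2≤n (𝟘 G)))

module DifferenceCounts (G : FinAbGroup n) (A : Fin m → Subset n) where

  open FinAbGroupProperties G
  open AbelianGroup abelianGroup using (_∙_; _-_; _⁻¹)

  𝟙 : Fin m → Fin n → ℕ
  𝟙 i x = ind (memB G A i x)

  -- diffMult G A i g unfolds to Σℕ m (λ j → ind≢ j i * pairCount i j g).
  pairCount : Fin m → Fin m → Fin n → ℕ
  pairCount i j g = Σℕ n (λ x → Σℕ n (λ y → 𝟙 i x * 𝟙 j y * ind ((x - y) == g)))

  ∣A∣≡Σ𝟙 : ∀ i → ∣ A i ∣ ≡ Σℕ n (𝟙 i)
  ∣A∣≡Σ𝟙 i = ∣p∣≡Σℕ-lookup (A i)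

  pairCount-shift : ∀ i j g → pairCount i j g ≡ Σℕ n (λ x → 𝟙 i x * 𝟙 j (x - g))
  pairCount-shift i j g = Σℕ-cong n λ x →
    trans (Σℕ-cong n (λ y → cong (λ b → 𝟙 i x * 𝟙 j y * ind b) (==-cong (sym ∘ -‿swap) (-‿swap ∘ sym))))
          (Σℕ-delta n (x - g) (λ y → 𝟙 i x * 𝟙 j y))

  Σℕ-pairCount : ∀ i j → Σℕ n (pairCount i j) ≡ ∣ A i ∣ * ∣ A j ∣
  Σℕ-pairCount i j = begin
    Σℕ n (λ g → Σℕ n (λ x → Σℕ n (λ y → P x y * ind ((x - y) == g))))
      ≡⟨ Σℕ-comm n n _ ⟩
    Σℕ n (λ x → Σℕ n (λ g → Σℕ n (λ y → P x y * ind ((x - y) == g))))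
      ≡⟨ Σℕ-cong n (λ x → trans (Σℕ-comm n n _) (Σℕ-cong n (λ y → one-difference x y))) ⟩
    Σℕ n (λ x → Σℕ n (P x))
      ≡⟨ Σℕ-cong n (λ x → sym (*-distribˡ-Σℕ n (𝟙 i x) (𝟙 j))) ⟩
    Σℕ n (λ x → 𝟙 i x * Σℕ n (𝟙 j))
      ≡⟨ sym (*-distribʳ-Σℕ n (Σℕ n (𝟙 j)) (𝟙 i)) ⟩
    Σℕ n (𝟙 i) * Σℕ n (𝟙 j)
      ≡⟨ sym (cong₂ _*_ (∣A∣≡Σ𝟙 i) (∣A∣≡Σ𝟙 j)) ⟩
    ∣ A i ∣ * ∣ A j ∣
      ∎
    where
    open ≡-Reasoning
    P : Fin n → Fin n → ℕ
    P x y = 𝟙 i x * 𝟙 j y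
    one-difference : ∀ x y → Σℕ n (λ g → P x y * ind ((x - y) == g)) ≡ P x y
    one-difference x y = trans (Σℕ-cong n (λ g → cong (λ b → P x y * ind b) (==-sym (x - y) g)))
                               (Σℕ-delta n (x - y) (λ _ → P x y))

  Σℕ-diffMult : ∀ s → Σℕ n (diffMult G A s) ≡ ∣ A s ∣ * Σℕ m (λ j → ind≢ j s * ∣ A j ∣)
  Σℕ-diffMult s = begin
    Σℕ n (λ g → Σℕ m (λ j → ind≢ j s * pairCount s j g))
      ≡⟨ Σℕ-comm n m _ ⟩
    Σℕ m (λ j → Σℕ n (λ g → ind≢ j s * pairCount s j g))
      ≡⟨ Σℕ-cong m (λ j → trans (sym (*-distribˡ-Σℕ n (ind≢ j s) _)) (cong (ind≢ j s *_) (Σℕ-pairCount s j))) ⟩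
    Σℕ m (λ j → ind≢ j s * (∣ A s ∣ * ∣ A j ∣))
      ≡⟨ Σℕ-cong m (λ j → x∙yz≈y∙xz (ind≢ j s) ∣ A s ∣ ∣ A j ∣) ⟩
    Σℕ m (λ j → ∣ A s ∣ * (ind≢ j s * ∣ A j ∣))
      ≡⟨ sym (*-distribˡ-Σℕ m ∣ A s ∣ _) ⟩
    ∣ A s ∣ * Σℕ m (λ j → ind≢ j s * ∣ A j ∣)
      ∎
    where open ≡-Reasoning

  totalSize∸∣A∣ : ∀ s → totalSize G A ∸ ∣ A s ∣ ≡ Σℕ m (λ j → ind≢ j s * ∣ A j ∣)
  totalSize∸∣A∣ s = trans (cong (_∸ ∣ A s ∣) (Σℕ-split m s (λ j → ∣ A j ∣))) (ℕP.m+n∸m≡n ∣ A s ∣ _)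

  winCount : Fin m → Fin n → ℕ
  winCount s Δ = Σℕ n (λ g → 𝟙 s g * ind (inOthers G A s (g ∙ Δ)))

  winShift≡frac-winCount : ∀ s Δ → winShift G A s Δ ≡ frac (winCount s Δ) ∣ A s ∣
  winShift≡frac-winCount s Δ = trans
    (Σℚ-cong n (λ g → if-frac (inOthers G A s (g ∙ Δ)) (𝟙 s g) ∣ A s ∣))
    (Σℚ-frac n _ ∣ A s ∣)

  module _ (disjoint : PairwiseDisjoint G A) where

    memB-unique : ∀ h i j → memB G A i h ≡ true → memB G A j h ≡ true → i ≡ j
    memB-unique h i j h∈Ai h∈Aj with i ≟ j
    ... | yes i≡j = i≡j
    ... | no  i≢j = ⊥-elim (disjoint i j i≢j h (lookup⇒[]= h (A i) h∈Ai) (lookup⇒[]= h (A j) h∈Aj))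

    ind-inOthers : ∀ s h → ind (inOthers G A s h) ≡ Σℕ m (λ j → ind≢ j s * 𝟙 j h)
    ind-inOthers s h = trans
      (ind-anyFin m _ (λ i j p q → memB-unique h i j (∧-conicalʳ _ _ p) (∧-conicalʳ _ _ q)))
      (Σℕ-cong m (λ j → ind-∧ (not (j == s)) (memB G A j h)))

    winCount≡diffMult : ∀ s Δ → winCount s Δ ≡ diffMult G A s (Δ ⁻¹)
    winCount≡diffMult s Δ = begin
      Σℕ n (λ g → 𝟙 s g * ind (inOthers G A s (g ∙ Δ)))
        ≡⟨ Σℕ-cong n (λ g → cong (𝟙 s g *_) (ind-inOthers s (g ∙ Δ))) ⟩
      Σℕ n (λ g → 𝟙 s g * Σℕ m (λ j → ind≢ j s * 𝟙 j (g ∙ Δ)))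
        ≡⟨ Σℕ-cong n (λ g → trans (*-distribˡ-Σℕ m (𝟙 s g) _)
                                  (Σℕ-cong m (λ j → x∙yz≈y∙xz (𝟙 s g) (ind≢ j s) _))) ⟩
      Σℕ n (λ g → Σℕ m (λ j → ind≢ j s * (𝟙 s g * 𝟙 j (g ∙ Δ))))
        ≡⟨ Σℕ-comm n m _ ⟩
      Σℕ m (λ j → Σℕ n (λ g → ind≢ j s * (𝟙 s g * 𝟙 j (g ∙ Δ))))
        ≡⟨ Σℕ-cong m (λ j → sym (*-distribˡ-Σℕ n (ind≢ j s) _)) ⟩
      Σℕ m (λ j → ind≢ j s * Σℕ n (λ g → 𝟙 s g * 𝟙 j (g ∙ Δ)))
        ≡⟨ Σℕ-cong m (λ j → cong (ind≢ j s *_) (sym (shifted-pairs j))) ⟩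
      Σℕ m (λ j → ind≢ j s * pairCount s j (Δ ⁻¹))
        ∎
      where
      open ≡-Reasoning
      shifted-pairs : ∀ j → pairCount s j (Δ ⁻¹) ≡ Σℕ n (λ g → 𝟙 s g * 𝟙 j (g ∙ Δ))
      shifted-pairs j = trans (pairCount-shift s j (Δ ⁻¹))
                              (Σℕ-cong n (λ g → cong (λ h → 𝟙 s g * 𝟙 j h) (-‿⁻¹ g Δ)))

module _ (G : FinAbGroup n) (A : Fin m → Subset n) where

  open DifferenceCounts G A
  open FinAbGroupProperties G using (⁻¹-≢ε)

  module _ {λs : Fin m → ℕ}
           (diffMult-0 : ∀ i → diffMult G A i (𝟘 G) ≡ 0)
           (diffMult-λ : ∀ i g → g ≢ 𝟘 G → diffMult G A i g ≡ λs i) where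

    -- Double counting: both sides equal Σℕ n (diffMult G A s).
    λ-identity : ∀ s → λs s * (n ∸ 1) ≡ (totalSize G A ∸ ∣ A s ∣) * ∣ A s ∣
    λ-identity s = begin
      λs s * (n ∸ 1)
        ≡⟨ cong (λs s *_) (∸1≡Σℕ-ind≢ n (𝟘 G)) ⟩
      λs s * Σℕ n (λ g → ind≢ g (𝟘 G))
        ≡⟨ *-distribˡ-Σℕ n (λs s) _ ⟩
      Σℕ n (λ g → λs s * ind≢ g (𝟘 G))
        ≡⟨ Σℕ-cong n off-zero ⟩
      Σℕ n (λ g → ind≢ g (𝟘 G) * diffMult G A s g)
        ≡⟨ cong (_+ Σℕ n (λ g → ind≢ g (𝟘 G) * diffMult G A s g)) (sym (diffMult-0 s)) ⟩
      diffMult G A s (𝟘 G) + Σℕ n (λ g → ind≢ g (𝟘 G) * diffMult G A s g)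
        ≡⟨ sym (Σℕ-split n (𝟘 G) (diffMult G A s)) ⟩
      Σℕ n (diffMult G A s)
        ≡⟨ Σℕ-diffMult s ⟩
      ∣ A s ∣ * Σℕ m (λ j → ind≢ j s * ∣ A j ∣)
        ≡⟨ cong (∣ A s ∣ *_) (sym (totalSize∸∣A∣ s)) ⟩
      ∣ A s ∣ * (totalSize G A ∸ ∣ A s ∣)
        ≡⟨ ℕP.*-comm ∣ A s ∣ _ ⟩
      (totalSize G A ∸ ∣ A s ∣) * ∣ A s ∣
        ∎
      where
      open ≡-Reasoning
      off-zero : ∀ g → λs s * ind≢ g (𝟘 G) ≡ ind≢ g (𝟘 G) * diffMult G A s g
      off-zero g with g ≟ 𝟘 G
      ... | yes refl = ℕP.*-zeroʳ (λs s)
      ... | no  g≢0  = begin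
        λs s * 1                 ≡⟨ ℕP.*-identityʳ (λs s) ⟩
        λs s                     ≡⟨ sym (diffMult-λ s g g≢0) ⟩
        diffMult G A s g         ≡⟨ sym (ℕP.*-identityˡ (diffMult G A s g)) ⟩
        1 * diffMult G A s g     ∎

    winShift-constant : PairwiseDisjoint G A → 2 ≤ n → (∀ i → 1 ≤ ∣ A i ∣) →
      ∀ s Δ → Δ ≢ 𝟘 G → winShift G A s Δ ≡ frac (totalSize G A ∸ ∣ A s ∣) (n ∸ 1)
    winShift-constant disjoint 2≤n nonempty s Δ Δ≢0 = begin
      winShift G A s Δ
        ≡⟨ winShift≡frac-winCount s Δ ⟩
      frac (winCount s Δ) ∣ A s ∣
        ≡⟨ cong (λ c → frac c ∣ A s ∣) (winCount≡diffMult disjoint s Δ) ⟩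
      frac (diffMult G A s (⊖_ G Δ)) ∣ A s ∣
        ≡⟨ cong (λ c → frac c ∣ A s ∣) (diffMult-λ s (⊖_ G Δ) (⁻¹-≢ε Δ≢0)) ⟩
      frac (λs s) ∣ A s ∣
        ≡⟨ frac-cross _ _ _ _ (nonempty s) (ℕP.∸-monoˡ-≤ 1 2≤n) (λ-identity s) ⟩
      frac (totalSize G A ∸ ∣ A s ∣) (n ∸ 1)
        ∎
      where open ≡-Reasoning

mainTheorem16 : (n m : ℕ) (G : FinAbGroup n) (A : Fin m → Subset n)
    (k : Fin m → ℕ) (λs : Fin m → ℕ)
    → 2 ≤ n
    → (∀ i → 1 ≤ ∣ A i ∣)
    → IsGSEDF G A k λs
    → IsROptimal G A × (∀ i → IsMaxWinProb G A i (frac (Σℕ m k ∸ k i) (n ∸ 1)))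
mainTheorem16 n m G A k λs 2≤n nonempty (disjoint , ∣A∣≡k , diffMult-0 , diffMult-λ) =
  R-optimal , λ i → subst (λ a → IsMaxWinProb G A i (frac a (n ∸ 1)))
                          (cong₂ _∸_ (Σℕ-cong m ∣A∣≡k) (∣A∣≡k i)) (R-optimal i)
  where
  R-optimal : IsROptimal G A
  R-optimal s = constant-winShift⇒IsMaxWinProb G A 2≤n s _
    (winShift-constant G A diffMult-0 diffMult-λ disjoint 2≤n nonempty s)
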